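{- Let $\mathcal{F}=\{i_{\alpha\beta}:\mathbb{B}_\alpha\to\mathbb{B}_\beta:\alpha\le\beta<\lambda\}$ be a complete iteration system. Then ${\sf RO}(C(\mathcal{F}))$ is isomorphic (as a partial order) to \[ D=\Big\{f\in T(\mathcal{F}):f=\tilde\bigvee\{g\in C(\mathcal{F}):g\le f\}\Big\}, \] ordered pointwise, via the map sending a regular open set $U$ to $\tilde\bigvee U$, with inverse $f\mapsto\{g\in C(\mathcal{F}):g\le f\}$.
   Context: A regular embedding is an injective boolean homomorphism preserving arbitrary suprema, with retraction $\pi_i(c)=\bigwedge\{b:i(b)\ge c\}$. A complete iteration system: complete boolean algebras $\mathbb{B}_\alpha$, regular embeddings $i_{\alpha\beta}$ with retractions $\pi_{\alpha\beta}$, $i_{\alpha\alpha}=\mathrm{id}$, $i_{\beta\gamma}\circ i_{\alpha\beta}=i_{\alpha\gamma}$. $T(\mathcal{F})=\{f\in\prod_{\alpha<\lambda}\mathbb{B}_\alpha:\pi_{\alpha\beta}(f(\beta))=f(\alpha)\ \forall\alpha\le\beta<\lambda\}$, ordered pointwise; $C(\mathcal{F})$ is the set of threads $f$ such that for some $\alpha$, $f(\beta)=i_{\alpha\beta}(f(\alpha))$ for all $\beta\ge\alpha$. For $A\subseteq T(\mathcal{F})$, the pointwise supremum $\tilde\bigvee A$ is the thread $\langle\bigvee\{f(\alpha):f\in A\}:\alpha<\lambda\rangle$. ${\sf RO}(C(\mathcal{F}))$ is the complete boolean algebra of regular open subsets of the poset $C(\mathcal{F})$ (with the topology whose basic open sets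 are the down-sets $\{g:g\le f\}$), i.e. its boolean completion, ordered by inclusion. -}

module Defs where

open import Level using (0ℓ)
open import Data.Product using (Σ; ∃; ∃-syntax; _×_; _,_; proj₁; proj₂)
open import Relation.Binary.PropositionalEquality using (_≡_; _≢_)
open import Relation.Binary.Structures using (IsPartialOrder; IsTotalOrder)
open import Induction.WellFounded using (WellFounded)
open import Relation.Nullary using (¬_)
open import Function.Definitions using (Injective)
open import Function.Bundles using (_⇔_)

record CBA : Set₁ where
  infix  4 _≤_
  infixr 7 _∧_
  infixr 6 _∨_
  field
    Car : Set
    _≤_ : Car → Car → Set
    isPartialOrder : IsPartialOrder _≡_ _≤_
    𝟘 𝟙 : Car
    _∧_ _∨_ : Car → Car → Car
    ∁ : Car → Car
    ⋁ ⋀ : (Car → Set) → Car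
    𝟘-min : ∀ x → 𝟘 ≤ x
    𝟙-max : ∀ x → x ≤ 𝟙
    ∧-lb₁ : ∀ x y → x ∧ y ≤ x
    ∧-lb₂ : ∀ x y → x ∧ y ≤ y
    ∧-glb : ∀ x y z → z ≤ x → z ≤ y → z ≤ x ∧ y
    ∨-ub₁ : ∀ x y → x ≤ x ∨ y
    ∨-ub₂ : ∀ x y → y ≤ x ∨ y
    ∨-lub : ∀ x y z → x ≤ z → y ≤ z → x ∨ y ≤ z
    ⋁-ub  : ∀ (P : Car → Set) x → P x → x ≤ ⋁ P
    ⋁-lub : ∀ (P : Car → Set) z → (∀ x → P x → x ≤ z) → ⋁ P ≤ z
    ⋀-lb  : ∀ (P : Car → Set) x → P x → ⋀ P ≤ x
    ⋀-glb : ∀ (P : Car → Set) z → (∀ x → P x → z ≤ x) → z ≤ ⋀ P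
    ∧-distrib-∨ : ∀ x y z → x ∧ (y ∨ z) ≡ (x ∧ y) ∨ (x ∧ z)
    ∁-∧ : ∀ x → x ∧ ∁ x ≡ 𝟘
    ∁-∨ : ∀ x → x ∨ ∁ x ≡ 𝟙

open CBA public

Image : {A B : Set} → (A → B) → (A → Set) → (B → Set)
Image h P y = ∃[ x ] (P x × h x ≡ y)

record IsRegularEmbedding (𝔸 𝔹 : CBA) (i : Car 𝔸 → Car 𝔹) : Set₁ where
  field
    injective : Injective _≡_ _≡_ i
    pres-𝟘 : i (𝟘 𝔸) ≡ 𝟘 𝔹
    pres-𝟙 : i (𝟙 𝔸) ≡ 𝟙 𝔹
    pres-∧ : ∀ x y → i (_∧_ 𝔸 x y) ≡ _∧_ 𝔹 (i x) (i y)
    pres-∨ : ∀ x y → i (_∨_ 𝔸 x y) ≡ _∨_ 𝔹 (i x) (i y)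
    pres-∁ : ∀ x → i (∁ 𝔸 x) ≡ ∁ 𝔹 (i x)
    pres-⋁ : ∀ (P : Car 𝔸 → Set) → i (⋁ 𝔸 P) ≡ ⋁ 𝔹 (Image i P)

retraction : (𝔸 𝔹 : CBA) → (Car 𝔸 → Car 𝔹) → Car 𝔹 → Car 𝔸
retraction 𝔸 𝔹 i c = ⋀ 𝔸 (λ b → _≤_ 𝔹 c (i b))

-- The ordinal λ: a well-ordered index type

record WellOrder : Set₁ where
  field
    Ix : Set
    _≼_ : Ix → Ix → Set
    isTotalOrder : IsTotalOrder _≡_ _≼_
    wellFounded : WellFounded (λ α β → α ≼ β × α ≢ β)

record CIS (Λ : WellOrder) : Set₁ where
  open WellOrder Λ
  field
    𝔹 : Ix → CBA
    i : ∀ α β → α ≼ β → Car (𝔹 α) → Car (𝔹 β)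
    regular : ∀ α β (p : α ≼ β) → IsRegularEmbedding (𝔹 α) (𝔹 β) (i α β p)
    i-id : ∀ α (p : α ≼ α) x → i α α p x ≡ x
    i-comp : ∀ α β γ (p : α ≼ β) (q : β ≼ γ) (r : α ≼ γ) x →
             i β γ q (i α β p x) ≡ i α γ r x

module _ {Λ : WellOrder} (ℱ : CIS Λ) where
  open WellOrder Λ
  open CIS ℱ

  π : ∀ α β → α ≼ β → Car (𝔹 β) → Car (𝔹 α)
  π α β p = retraction (𝔹 α) (𝔹 β) (i α β p)

  Prod : Set
  Prod = (α : Ix) → Car (𝔹 α)

  _≤ₚ_ : Prod → Prod → Set
  f ≤ₚ g = ∀ α → _≤_ (𝔹 α) (f α) (g α)

  _≐ₚ_ : Prod → Prod → Set
  f ≐ₚ g = ∀ α → f α ≡ g α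

  IsThread : Prod → Set
  IsThread f = ∀ α β (p : α ≼ β) → π α β p (f β) ≡ f α

  Thread : Set
  Thread = Σ Prod IsThread

  _≤ₜ_ : Thread → Thread → Set
  f ≤ₜ g = proj₁ f ≤ₚ proj₁ g

  InC : Thread → Set
  InC f = ∃[ α ] (∀ β (p : α ≼ β) → proj₁ f β ≡ i α β p (proj₁ f α))

  NonZero : Thread → Set
  NonZero f = ¬ (∀ α → proj₁ f α ≡ 𝟘 (𝔹 α))

  ~⋁ : (Thread → Set) → Prod
  ~⋁ A α = ⋁ (𝔹 α) (λ b → ∃[ f ] (A f × proj₁ f α ≡ b))

  InD : Thread → Set
  InD f = proj₁ f ≐ₚ ~⋁ (λ g → InC g × g ≤ₜ f)

  -- The forcing poset C(ℱ)⁺ (nonzero elements of C(ℱ)), pointwise order,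
  -- and its regular open sets for the topology generated by the down-sets
  -- ↓f = { g : g ≤ f }.

  Cpos : Set
  Cpos = Σ Thread (λ f → InC f × NonZero f)

  _≤c_ : Cpos → Cpos → Set
  x ≤c y = proj₁ x ≤ₜ proj₁ y

  Closure : (Cpos → Set) → (Cpos → Set)
  Closure U x = ∀ f → x ≤c f → ∃[ z ] (z ≤c f × U z)

  Interior : (Cpos → Set) → (Cpos → Set)
  Interior S x = ∃[ f ] (x ≤c f × (∀ g → g ≤c f → S g))

  IsRegularOpen : (Cpos → Set) → Set
  IsRegularOpen U = ∀ x → (U x ⇔ Interior (Closure U) x)

  Φ : (Cpos → Set) → Prod
  Φ U = ~⋁ (λ g → Σ (InC g × NonZero g) (λ h → U (g , h)))

  Ψ : Thread → (Cpos → Set)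
  Ψ f g = proj₁ g ≤ₜ f

  _⊆_ : (Cpos → Set) → (Cpos → Set) → Set
  U ⊆ V = ∀ x → U x → V x

  _≐_ : (Cpos → Set) → (Cpos → Set) → Set
  U ≐ V = ∀ x → U x ⇔ V x

  IsoStatement : Set₁
  IsoStatement =
      (∀ U → IsRegularOpen U →
         Σ (IsThread (Φ U)) (λ t → InD (Φ U , t)))
    × (∀ f → InD f → IsRegularOpen (Ψ f))
    × (∀ U → IsRegularOpen U → (t : IsThread (Φ U)) → Ψ (Φ U , t) ≐ U)
    × (∀ f → InD f → Φ (Ψ f) ≐ₚ proj₁ f)
    × (∀ U V → IsRegularOpen U → IsRegularOpen V → (U ⊆ V ⇔ Φ U ≤ₚ Φ V))

module Submission where

-- The proof rests on one construction: an element b of a stage 𝔹_β generates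
-- the thread ⟨b⟩ that equals π_{γβ}(b) below β and i_{βγ}(b) above β.  It lies
-- in C(ℱ), and it lies below every C-thread supported at or below β whose
-- value at β dominates b.  Together with the fact that a thread vanishing at one
-- stage vanishes everywhere, this gives the two combinatorial facts about C(ℱ)⁺:
--   * separation: if x ∈ C(ℱ)⁺ is not below a thread f, some nonzero ⟨b⟩ ≤ x is
--     incompatible with everything below f, so {g ∈ C(ℱ) : g ≤ f} is regular open;
--   * density: every element of C(ℱ)⁺ below ~⋁ U is in the closure of U, for U
--     downward closed, so Ψ (Φ U) = U for U regular open.
-- Pointwise suprema of threads are threads and ~⋁ of C-threads lies in D, so
-- Φ maps into D; Φ ∘ Ψ = id on D because zero threads add nothing to a supremum.

open import Level using (0ℓ)
open import Axiom.ExcludedMiddle using (ExcludedMiddle)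
open import Data.Product using (Σ; ∃-syntax; _×_; _,_; proj₁; proj₂)
open import Data.Sum using (inj₁; inj₂)
open import Data.Empty using (⊥-elim)
open import Relation.Nullary using (¬_; Dec; yes; no)
open import Relation.Nullary.Decidable using (decidable-stable)
open import Relation.Binary.PropositionalEquality
  using (_≡_; _≢_; refl; sym; trans; cong; subst; subst₂; module ≡-Reasoning)
open import Relation.Binary.Bundles using (Poset)
open import Relation.Binary.Structures using (IsPartialOrder; IsTotalOrder)
import Relation.Binary.Reasoning.PartialOrder as PosetReasoning
open import Function.Bundles using (_⇔_; mk⇔; Equivalence)
open import Defs using (CBA; Image; IsRegularEmbedding; retraction; WellOrder; CIS; IsoStatement)
import Defs as D

module BooleanAlgebra (𝔸 : CBA) where
  open CBA 𝔸 public
  open IsPartialOrder isPartialOrder public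
    using (antisym) renaming (refl to ≤-refl; trans to ≤-trans)

  poset : Poset 0ℓ 0ℓ 0ℓ
  poset = record { isPartialOrder = isPartialOrder }

  module ≤-Reasoning = PosetReasoning poset

  ≤-respects : ∀ {a a' b b'} → a ≡ a' → b ≡ b' → a ≤ b → a' ≤ b'
  ≤-respects ea eb = subst₂ _≤_ ea eb

  ≤𝟘⇒≡𝟘 : ∀ {x} → x ≤ 𝟘 → x ≡ 𝟘
  ≤𝟘⇒≡𝟘 {x} h = antisym h (𝟘-min x)

  ≤⇒∧≡ : ∀ {x y} → x ≤ y → x ∧ y ≡ x
  ≤⇒∧≡ {x} {y} h = antisym (∧-lb₁ x y) (∧-glb x y x ≤-refl h)

  ∧-comm : ∀ x y → x ∧ y ≡ y ∧ x
  ∧-comm x y = antisym (∧-glb y x (x ∧ y) (∧-lb₂ x y) (∧-lb₁ x y))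
                       (∧-glb x y (y ∧ x) (∧-lb₂ y x) (∧-lb₁ y x))

  ∨-comm : ∀ x y → x ∨ y ≡ y ∨ x
  ∨-comm x y = antisym (∨-lub x y (y ∨ x) (∨-ub₂ y x) (∨-ub₁ y x))
                       (∨-lub y x (x ∨ y) (∨-ub₂ x y) (∨-ub₁ x y))

  disjoint-cover⇒≤ : ∀ {x a b} → x ∧ a ≡ 𝟘 → a ∨ b ≡ 𝟙 → x ≤ b
  disjoint-cover⇒≤ {x} {a} {b} x∧a≡𝟘 a∨b≡𝟙 = begin
    x                  ≤⟨ ∧-glb x (a ∨ b) x ≤-refl (subst (x ≤_) (sym a∨b≡𝟙) (𝟙-max x)) ⟩
    x ∧ (a ∨ b)        ≡⟨ ∧-distrib-∨ x a b ⟩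
    (x ∧ a) ∨ (x ∧ b)  ≤⟨ ∨-lub _ _ b (subst (_≤ b) (sym x∧a≡𝟘) (𝟘-min b)) (∧-lb₂ x b) ⟩
    b                  ∎
    where open ≤-Reasoning

  disjoint⇒≤∁ : ∀ {x y} → x ∧ y ≡ 𝟘 → x ≤ ∁ y
  disjoint⇒≤∁ {y = y} e = disjoint-cover⇒≤ e (∁-∨ y)

  below-both⇒𝟘 : ∀ {z y} → z ≤ y → z ≤ ∁ y → z ≡ 𝟘
  below-both⇒𝟘 {z} {y} h k = ≤𝟘⇒≡𝟘 (subst (z ≤_) (∁-∧ y) (∧-glb y (∁ y) z h k))

  ≤∁∁ : ∀ {x} → x ≤ ∁ (∁ x)
  ≤∁∁ {x} = disjoint⇒≤∁ (∁-∧ x)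

  ∁∁≤ : ∀ {x} → ∁ (∁ x) ≤ x
  ∁∁≤ {x} = disjoint-cover⇒≤ (trans (∧-comm (∁ (∁ x)) (∁ x)) (∁-∧ (∁ x)))
                             (trans (∨-comm (∁ x) x) (∁-∨ x))

  ∁-disjoint⇒≤ : ∀ {x y} → x ∧ ∁ y ≡ 𝟘 → x ≤ y
  ∁-disjoint⇒≤ e = ≤-trans (disjoint⇒≤∁ e) ∁∁≤

  ∁-antitone : ∀ {x y} → x ≤ y → ∁ y ≤ ∁ x
  ∁-antitone {x} {y} h =
    disjoint⇒≤∁ (below-both⇒𝟘 (≤-trans (∧-lb₂ (∁ y) x) h) (∧-lb₁ (∁ y) x))

  ∁⋀≤⋁∁ : ∀ (P : Car → Set) → ∁ (⋀ P) ≤ ⋁ (λ z → ∃[ b ] (P b × ∁ b ≡ z))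
  ∁⋀≤⋁∁ P = ≤-trans (∁-antitone ∁⋁∁≤⋀) ∁∁≤
    where
    ∁⋁∁≤⋀ : ∁ (⋁ (λ z → ∃[ b ] (P b × ∁ b ≡ z))) ≤ ⋀ P
    ∁⋁∁≤⋀ = ⋀-glb P _ λ b pb → ≤-trans (∁-antitone (⋁-ub _ (∁ b) (b , pb , refl))) ∁∁≤

-- A regular embedding i : 𝔸 → 𝔹 is an order embedding, and its retraction
-- π(c) = ⋀ {b : c ≤ i b} is its left adjoint: π c ≤ b ⇔ c ≤ i b.
module RegularEmbedding {𝔸 𝔹 : CBA} {i : CBA.Car 𝔸 → CBA.Car 𝔹} (R : IsRegularEmbedding 𝔸 𝔹 i) where
  private
    module A = BooleanAlgebra 𝔸
    module B = BooleanAlgebra 𝔹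
  open IsRegularEmbedding R public

  π : CBA.Car 𝔹 → CBA.Car 𝔸
  π = retraction 𝔸 𝔹 i

  -- i preserves and reflects the order (it preserves meets and is injective).
  monotone : ∀ {x y} → x A.≤ y → i x B.≤ i y
  monotone {x} {y} h =
    subst (B._≤ i y) (trans (sym (pres-∧ x y)) (cong i (A.≤⇒∧≡ h))) (B.∧-lb₂ (i x) (i y))

  reflects : ∀ {x y} → i x B.≤ i y → x A.≤ y
  reflects {x} {y} h = subst (A._≤ y) (injective (trans (pres-∧ x y) (B.≤⇒∧≡ h))) (A.∧-lb₂ x y)

  π-least : ∀ {c b} → c B.≤ i b → π c A.≤ b
  π-least {b = b} h = A.⋀-lb _ b h

  -- The unit of the adjunction; this is where preservation of suprema is used:
  -- ∁ (i (π c)) = i (∁ ⋀{b : c ≤ i b}) ≤ ⋁ {∁ (i b) : c ≤ i b} ≤ ∁ c.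
  unit : ∀ {c} → c B.≤ i (π c)
  unit {c} = B.≤-trans B.≤∁∁ (B.≤-trans (B.∁-antitone ∁iπc≤∁c) B.∁∁≤)
    where
    P : CBA.Car 𝔸 → Set
    P b = c B.≤ i b
    Q : CBA.Car 𝔸 → Set
    Q z = ∃[ b ] (P b × A.∁ b ≡ z)
    ⋁iQ≤∁c : B.⋁ (Image i Q) B.≤ B.∁ c
    ⋁iQ≤∁c = B.⋁-lub _ _ λ { _ (_ , (b , pb , refl) , refl) →
      subst (B._≤ B.∁ c) (sym (pres-∁ b)) (B.∁-antitone pb) }
    ∁iπc≤∁c : B.∁ (i (π c)) B.≤ B.∁ c
    ∁iπc≤∁c = begin
      B.∁ (i (A.⋀ P))      ≡⟨ sym (pres-∁ (A.⋀ P)) ⟩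
      i (A.∁ (A.⋀ P))      ≤⟨ monotone (A.∁⋀≤⋁∁ P) ⟩
      i (A.⋁ Q)            ≡⟨ pres-⋁ Q ⟩
      B.⋁ (Image i Q)      ≤⟨ ⋁iQ≤∁c ⟩
      B.∁ c                ∎
      where open B.≤-Reasoning

  π-monotone : ∀ {c c'} → c B.≤ c' → π c A.≤ π c'
  π-monotone h = π-least (B.≤-trans h unit)

  π∘i : ∀ x → π (i x) ≡ x
  π∘i x = A.antisym (π-least B.≤-refl) (reflects unit)

  π-𝟘 : π B.𝟘 ≡ A.𝟘
  π-𝟘 = A.≤𝟘⇒≡𝟘 (π-least (B.𝟘-min _))

module IterationSystem {Λ : WellOrder} (ℱ : CIS Λ) where
  open WellOrder Λ
  open CIS ℱ
  open IsTotalOrder isTotalOrder using (total) renaming (refl to ≼-refl; trans to ≼-trans)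

  Stage : Ix → Set
  Stage α = CBA.Car (𝔹 α)

  module B (α : Ix) = BooleanAlgebra (𝔹 α)
  module E (α β : Ix) (p : α ≼ β) = RegularEmbedding (regular α β p)

  stage-≤ : (α : Ix) → Stage α → Stage α → Set
  stage-≤ α = CBA._≤_ (𝔹 α)
  syntax stage-≤ α x y = x ≤[ α ] y

  stage-∧ : (α : Ix) → Stage α → Stage α → Stage α
  stage-∧ α = CBA._∧_ (𝔹 α)
  syntax stage-∧ α x y = x ∧[ α ] y

  π : ∀ α β → α ≼ β → Stage β → Stage α
  π = D.π ℱ
  Prod : Set
  Prod = D.Prod ℱ
  IsThread : Prod → Set
  IsThread = D.IsThread ℱ
  Thread : Set
  Thread = D.Thread ℱ
  InC : Thread → Set
  InC = D.InC ℱ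
  NonZero : Thread → Set
  NonZero = D.NonZero ℱ
  InD : Thread → Set
  InD = D.InD ℱ
  ~⋁ : (Thread → Set) → Prod
  ~⋁ = D.~⋁ ℱ
  Cpos : Set
  Cpos = D.Cpos ℱ
  Closure Interior : (Cpos → Set) → (Cpos → Set)
  Closure = D.Closure ℱ
  Interior = D.Interior ℱ
  IsRegularOpen : (Cpos → Set) → Set
  IsRegularOpen = D.IsRegularOpen ℱ
  Φ : (Cpos → Set) → Prod
  Φ = D.Φ ℱ
  Ψ : Thread → (Cpos → Set)
  Ψ = D.Ψ ℱ

  infix 4 _≤ₚ_ _≐ₚ_ _≤ₜ_ _≤c_ _⊆_ _≐_
  _≤ₚ_ _≐ₚ_ : Prod → Prod → Set
  _≤ₚ_ = D._≤ₚ_ ℱ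
  _≐ₚ_ = D._≐ₚ_ ℱ
  _≤ₜ_ : Thread → Thread → Set
  _≤ₜ_ = D._≤ₜ_ ℱ
  _≤c_ : Cpos → Cpos → Set
  _≤c_ = D._≤c_ ℱ
  _⊆_ _≐_ : (Cpos → Set) → (Cpos → Set) → Set
  _⊆_ = D._⊆_ ℱ
  _≐_ = D._≐_ ℱ

  ≤ₚ-refl : ∀ {f} → f ≤ₚ f
  ≤ₚ-refl α = B.≤-refl α

  ≤ₚ-trans : ∀ {f g h} → f ≤ₚ g → g ≤ₚ h → f ≤ₚ h
  ≤ₚ-trans f≤g g≤h α = B.≤-trans α (f≤g α) (g≤h α)

  pt : Cpos → Prod
  pt x = proj₁ (proj₁ x)

  UpperBound : Ix → Ix → Set
  UpperBound α β = ∃[ δ ] (α ≼ δ × β ≼ δ)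

  upper-bound : ∀ α β → UpperBound α β
  upper-bound α β with total α β
  ... | inj₁ α≼β = β , α≼β , ≼-refl
  ... | inj₂ β≼α = α , ≼-refl , β≼α

  π-id : ∀ α (p : α ≼ α) c → π α α p c ≡ c
  π-id α p c = trans (cong (π α α p) (sym (i-id α p c))) (E.π∘i α α p c)

  π-comp : ∀ γ δ β (q : γ ≼ δ) (r : δ ≼ β) (s : γ ≼ β) c →
           π γ δ q (π δ β r c) ≡ π γ β s c
  π-comp γ δ β q r s c = B.antisym γ
    (E.π-least γ δ q (E.π-least δ β r
      (subst (stage-≤ β c) (sym (i-comp γ δ β q r s _)) (E.unit γ β s))))
    (E.π-least γ β s (B.≤-trans β (E.unit δ β r)
      (subst (stage-≤ β _) (i-comp γ δ β q r s _) (E.monotone δ β r (E.unit γ δ q)))))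

  thread-≤-lift : ∀ {f} → IsThread f → ∀ {β γ} (p : β ≼ γ) → f γ ≤[ γ ] i β γ p (f β)
  thread-≤-lift {f} t {β} {γ} p = subst (λ w → f γ ≤[ γ ] i β γ p w) (t β γ p) (E.unit β γ p)

  thread-vanishes : ∀ {f} → IsThread f → ∀ {β} → f β ≡ B.𝟘 β → ∀ γ → f γ ≡ B.𝟘 γ
  thread-vanishes {f} t {β} fβ≡𝟘 γ with total γ β
  ... | inj₁ γ≼β = begin
    f γ                 ≡⟨ sym (t γ β γ≼β) ⟩
    π γ β γ≼β (f β)     ≡⟨ cong (π γ β γ≼β) fβ≡𝟘 ⟩
    π γ β γ≼β (B.𝟘 β)   ≡⟨ E.π-𝟘 γ β γ≼β ⟩
    B.𝟘 γ               ∎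
    where open ≡-Reasoning
  ... | inj₂ β≼γ = B.≤𝟘⇒≡𝟘 γ (begin
    f γ                 ≤⟨ thread-≤-lift t β≼γ ⟩
    i β γ β≼γ (f β)     ≡⟨ cong (i β γ β≼γ) fβ≡𝟘 ⟩
    i β γ β≼γ (B.𝟘 β)   ≡⟨ E.pres-𝟘 β γ β≼γ ⟩
    B.𝟘 γ               ∎)
    where open B.≤-Reasoning γ

  nonzero-at : (x : Cpos) → ∀ β → pt x β ≢ B.𝟘 β
  nonzero-at ((_ , t) , _ , nz) β e = nz (thread-vanishes t e)

  SupportedAt : Prod → Ix → Set
  SupportedAt f α = ∀ β (p : α ≼ β) → f β ≡ i α β p (f α)

  support-upward : ∀ {f α β} → SupportedAt f α → α ≼ β → SupportedAt f β
  support-upward {f} {α} {β} S α≼β γ β≼γ = begin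
    f γ                                 ≡⟨ S γ α≼γ ⟩
    i α γ α≼γ (f α)                     ≡⟨ sym (i-comp α β γ α≼β β≼γ α≼γ (f α)) ⟩
    i β γ β≼γ (i α β α≼β (f α))         ≡⟨ cong (i β γ β≼γ) (sym (S β α≼β)) ⟩
    i β γ β≼γ (f β)                     ∎
    where
    open ≡-Reasoning
    α≼γ = ≼-trans α≼β β≼γ

  -- b ∈ 𝔹_β seen at stage γ through a common upper bound δ: π_{γδ}(i_{βδ} b).
  -- The value does not depend on the choice of δ.
  through : ∀ {β γ} → UpperBound β γ → Stage β → Stage γ
  through {β} {γ} (δ , β≼δ , γ≼δ) b = π γ δ γ≼δ (i β δ β≼δ b)

  through-raise : ∀ {β γ δ δ'} (β≼δ : β ≼ δ) (γ≼δ : γ ≼ δ) (δ≼δ' : δ ≼ δ')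
                  (β≼δ' : β ≼ δ') (γ≼δ' : γ ≼ δ') b →
                  through (δ' , β≼δ' , γ≼δ') b ≡ through (δ , β≼δ , γ≼δ) b
  through-raise {β} {γ} {δ} {δ'} β≼δ γ≼δ δ≼δ' β≼δ' γ≼δ' b = begin
    π γ δ' γ≼δ' (i β δ' β≼δ' b)
      ≡⟨ cong (π γ δ' γ≼δ') (sym (i-comp β δ δ' β≼δ δ≼δ' β≼δ' b)) ⟩
    π γ δ' γ≼δ' (i δ δ' δ≼δ' (i β δ β≼δ b))
      ≡⟨ sym (π-comp γ δ δ' γ≼δ δ≼δ' γ≼δ' _) ⟩
    π γ δ γ≼δ (π δ δ' δ≼δ' (i δ δ' δ≼δ' (i β δ β≼δ b)))
      ≡⟨ cong (π γ δ γ≼δ) (E.π∘i δ δ' δ≼δ' _) ⟩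
    π γ δ γ≼δ (i β δ β≼δ b)
      ∎
    where open ≡-Reasoning

  -- Any two upper bounds give the same value (compare both with the larger one).
  through-indep : ∀ {β γ} (u v : UpperBound β γ) b → through u b ≡ through v b
  through-indep (δ , β≼δ , γ≼δ) (δ' , β≼δ' , γ≼δ') b with total δ δ'
  ... | inj₁ δ≼δ' = sym (through-raise β≼δ γ≼δ δ≼δ' β≼δ' γ≼δ' b)
  ... | inj₂ δ'≼δ = through-raise β≼δ' γ≼δ' δ'≼δ β≼δ γ≼δ b

  gen : ∀ β → Stage β → Prod
  gen β b γ = through (upper-bound β γ) b

  gen-above : ∀ {β γ} b (p : β ≼ γ) → gen β b γ ≡ i β γ p b
  gen-above {β} {γ} b p =
    trans (through-indep (upper-bound β γ) (γ , p , ≼-refl) b) (π-id γ ≼-refl _)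

  gen-below : ∀ {β γ} b (p : γ ≼ β) → gen β b γ ≡ π γ β p b
  gen-below {β} {γ} b p =
    trans (through-indep (upper-bound β γ) (β , ≼-refl , p) b) (cong (π γ β p) (i-id β ≼-refl b))

  gen-at : ∀ β b → gen β b β ≡ b
  gen-at β b = trans (gen-above b ≼-refl) (i-id β ≼-refl b)

  gen-thread : ∀ β b → IsThread (gen β b)
  gen-thread β b γ γ' γ≼γ' with upper-bound β γ'
  ... | δ , β≼δ , γ'≼δ = trans (π-comp γ γ' δ γ≼γ' γ'≼δ γ≼δ _)
                               (through-indep (δ , β≼δ , γ≼δ) (upper-bound β γ) b)
    where γ≼δ = ≼-trans γ≼γ' γ'≼δ

  gen-supported : ∀ β b → SupportedAt (gen β b) β
  gen-supported β b γ p = trans (gen-above b p) (cong (i β γ p) (sym (gen-at β b)))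

  genC : ∀ β b → b ≢ B.𝟘 β → Cpos
  genC β b b≢𝟘 = (gen β b , gen-thread β b) , (β , gen-supported β b) ,
                 λ vanishes → b≢𝟘 (trans (sym (gen-at β b)) (vanishes β))

  gen-≤ : ∀ {f α β b} → IsThread f → SupportedAt f α → α ≼ β → b ≤[ β ] f β → gen β b ≤ₚ f
  gen-≤ {f} {α} {β} {b} t S α≼β b≤fβ γ with total γ β
  ... | inj₁ γ≼β = B.≤-respects γ (sym (gen-below b γ≼β)) (t γ β γ≼β) (E.π-monotone γ β γ≼β b≤fβ)
  ... | inj₂ β≼γ = B.≤-respects γ (sym (gen-above b β≼γ)) (sym (support-upward S α≼β γ β≼γ))
                                  (E.monotone β γ β≼γ b≤fβ)

  disjoint-descends : ∀ {y} → IsThread y → ∀ {α β a} (p : α ≼ β) →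
                      i α β p a ∧[ β ] y β ≡ B.𝟘 β → a ∧[ α ] y α ≡ B.𝟘 α
  disjoint-descends {y} t {α} {β} {a} p e =
    B.below-both⇒𝟘 α (B.∧-lb₁ α a (y α)) (B.≤-trans α (B.∧-lb₂ α a (y α)) yα≤∁a)
    where
    yβ≤i∁a : y β ≤[ β ] i α β p (B.∁ α a)
    yβ≤i∁a = subst (stage-≤ β (y β)) (sym (E.pres-∁ α β p a))
                   (B.disjoint⇒≤∁ β (trans (B.∧-comm β (y β) _) e))
    yα≤∁a : y α ≤[ α ] B.∁ α a
    yα≤∁a = subst (λ w → w ≤[ α ] B.∁ α a) (t α β p) (E.π-least α β p yβ≤i∁a)

  ~⋁-upper : ∀ {A : Thread → Set} {f} → A f → proj₁ f ≤ₚ ~⋁ A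
  ~⋁-upper {f = f} af α = B.⋁-ub α _ _ (f , af , refl)

  ~⋁-least : ∀ {A : Thread → Set} {α a} → (∀ f → A f → proj₁ f α ≤[ α ] a) → ~⋁ A α ≤[ α ] a
  ~⋁-least {α = α} {a} k = B.⋁-lub α _ a λ { _ (f , af , refl) → k f af }

  -- ~⋁ A is a thread: π commutes with the supremum because of the adjunction.
  ~⋁-thread : ∀ (A : Thread → Set) → IsThread (~⋁ A)
  ~⋁-thread A α β p = B.antisym α
    (E.π-least α β p (~⋁-least λ f af →
      B.≤-trans β (thread-≤-lift (proj₂ f) p) (E.monotone α β p (~⋁-upper af α))))
    (~⋁-least λ f af →
      subst (λ w → w ≤[ α ] _) (proj₂ f α β p) (E.π-monotone α β p (~⋁-upper af β)))

  Φ-upper : ∀ {U} (u : Cpos) → U u → pt u ≤ₚ Φ U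
  Φ-upper u uU = ~⋁-upper (proj₂ u , uU)

  Φ-least : ∀ {U α a} → (∀ u → U u → pt u α ≤[ α ] a) → Φ U α ≤[ α ] a
  Φ-least k = ~⋁-least λ f (h , uU) → k (f , h) uU

  ~⋁-of-C-in-D : ∀ (A : Thread → Set) → (∀ g → A g → InC g) → InD (~⋁ A , ~⋁-thread A)
  ~⋁-of-C-in-D A A⊆C α = B.antisym α
    (~⋁-least λ f af → ~⋁-upper {A = λ g → InC g × g ≤ₜ (~⋁ A , ~⋁-thread A)} {f}
                                 (A⊆C f af , ~⋁-upper af) α)
    (~⋁-least λ g (_ , g≤) → g≤ α)

  Φ-in-D : ∀ U → Σ (IsThread (Φ U)) (λ t → InD (Φ U , t))
  Φ-in-D U = ~⋁-thread _ , ~⋁-of-C-in-D _ λ g ((c , _) , _) → c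

  regular-open-down : ∀ {U} → IsRegularOpen U → ∀ {x z} → U x → z ≤c x → U z
  regular-open-down {U} RO {x} {z} ux z≤x with Equivalence.to (RO x) ux
  ... | f , x≤f , K = Equivalence.from (RO z) (f , ≤ₚ-trans z≤x x≤f , K)

  -- Two C-threads, the first supported at α, whose values meet at α have a
  -- common lower bound in C(ℱ)⁺: the thread generated by their meet above both supports.
  common-lower-bound : (x : Thread) → ∀ {α} → SupportedAt (proj₁ x) α → (y : Cpos) →
                       proj₁ x α ∧[ α ] pt y α ≢ B.𝟘 α → ∃[ z ] (pt z ≤ₚ proj₁ x × z ≤c y)
  common-lower-bound (xf , xt) {α} Sx ((yf , yt) , (α' , Sy) , _) meet
    with upper-bound α α'
  ... | β , α≼β , α'≼β = genC β m m≢𝟘 , gen-≤ xt Sx α≼β (B.∧-lb₁ β _ _) ,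
                                        gen-≤ yt Sy α'≼β (B.∧-lb₂ β _ _)
    where
    m : Stage β
    m = xf β ∧[ β ] yf β
    m≢𝟘 : m ≢ B.𝟘 β
    m≢𝟘 e = meet (disjoint-descends yt α≼β (subst (λ w → w ∧[ β ] yf β ≡ B.𝟘 β) (Sx β α≼β) e))

  separation : (x : Cpos) (f : Thread) → ∀ {α} → ¬ (pt x α ≤[ α ] proj₁ f α) →
               ∃[ g ] (g ≤c x × ∀ z → z ≤c g → ¬ Ψ f z)
  separation x@((xf , xt) , (α' , S) , _) (ff , ft) {α} xα≰fα with upper-bound α α'
  ... | β , α≼β , α'≼β = genC β b b≢𝟘 , gen-≤ xt S α'≼β (B.∧-lb₁ β _ _) , incompatible
    where
    xβ≰fβ : ¬ (xf β ≤[ β ] ff β)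
    xβ≰fβ le = xα≰fα (B.≤-respects α (xt α β α≼β) (ft α β α≼β) (E.π-monotone α β α≼β le))
    b : Stage β
    b = xf β ∧[ β ] B.∁ β (ff β)
    b≢𝟘 : b ≢ B.𝟘 β
    b≢𝟘 e = xβ≰fβ (B.∁-disjoint⇒≤ β e)
    incompatible : ∀ z → z ≤c genC β b b≢𝟘 → ¬ Ψ (ff , ft) z
    incompatible z z≤g z≤f = nonzero-at z β (B.below-both⇒𝟘 β (z≤f β)
      (B.≤-trans β (z≤g β) (subst (λ w → w ≤[ β ] B.∁ β (ff β)) (sym (gen-at β b)) (B.∧-lb₂ β _ _))))

  module Classical (EM : ExcludedMiddle 0ℓ) where

    classical : ∀ {P : Set} → ¬ ¬ P → P
    classical = decidable-stable EM

    Ψ-regular : ∀ f → IsRegularOpen (Ψ f)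
    Ψ-regular f x = mk⇔ (λ x≤f → x , ≤ₚ-refl , λ g g≤x _ g≤h → g , g≤h , ≤ₚ-trans g≤x x≤f)
                         int-cl⇒Ψ
      where
      int-cl⇒Ψ : Interior (Closure (Ψ f)) x → Ψ f x
      int-cl⇒Ψ (h , x≤h , K) α = classical λ xα≰fα →
        let (g , g≤x , incompatible) = separation x f xα≰fα
            (z , z≤g , z≤f) = K g (≤ₚ-trans g≤x x≤h) g ≤ₚ-refl
        in incompatible z z≤g z≤f

    below-Φ-in-closure : ∀ U → (∀ {x z} → U x → z ≤c x → U z) →
                         ∀ g → pt g ≤ₚ Φ U → Closure U g
    below-Φ-in-closure U down g@((gf , gt) , (α , S) , _) g≤ΦU h g≤h
      with EM {∃[ u ] (U u × gf α ∧[ α ] pt u α ≢ B.𝟘 α)}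
    ... | yes (u , uU , meet) = let (z , z≤g , z≤u) = common-lower-bound (gf , gt) S u meet
                                in z , ≤ₚ-trans z≤g g≤h , down uU z≤u
    ... | no none = ⊥-elim (nonzero-at g α (B.below-both⇒𝟘 α (B.≤-refl α)
                      (B.≤-trans α (g≤ΦU α) ΦUα≤∁gα)))
      where
      ΦUα≤∁gα : Φ U α ≤[ α ] B.∁ α (gf α)
      ΦUα≤∁gα = Φ-least λ u uU → B.disjoint⇒≤∁ α
        (trans (B.∧-comm α _ _) (classical λ meet → none (u , uU , meet)))

    -- U ⊆ Ψ (Φ U) always; the converse is density together with regularity.
    Ψ∘Φ≐id : ∀ U → IsRegularOpen U → (t : IsThread (Φ U)) → Ψ (Φ U , t) ≐ U
    Ψ∘Φ≐id U RO _ x = mk⇔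
      (λ x≤ΦU → Equivalence.from (RO x) (x , ≤ₚ-refl , λ g g≤x →
         below-Φ-in-closure U (regular-open-down RO) g (≤ₚ-trans g≤x x≤ΦU)))
      (Φ-upper x)

    -- For f ∈ D, Φ (Ψ f) is f: the C⁺-elements below f have the same supremum
    -- as all C-elements below f.
    Φ∘Ψ≐id : ∀ f → InD f → Φ (Ψ f) ≐ₚ proj₁ f
    Φ∘Ψ≐id f f∈D α = trans (B.antisym α ≤-direction ≥-direction) (sym (f∈D α))
      where
      BelowInC : Thread → Set
      BelowInC g = InC g × g ≤ₜ f
      ≤-direction : Φ (Ψ f) α ≤[ α ] ~⋁ BelowInC α
      ≤-direction = ~⋁-least λ { g ((c , _) , g≤f) → ~⋁-upper {A = BelowInC} {g} (c , g≤f) α }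
      -- zero threads contribute nothing to the supremum
      case-zero : ∀ g → InC g → g ≤ₜ f → Dec (NonZero g) → proj₁ g α ≤[ α ] Φ (Ψ f) α
      case-zero g c g≤f (yes nz) = Φ-upper (g , c , nz) g≤f α
      case-zero g c g≤f (no z) =
        subst (λ w → w ≤[ α ] Φ (Ψ f) α) (sym (classical z α)) (B.𝟘-min α _)
      ≥-direction : ~⋁ BelowInC α ≤[ α ] Φ (Ψ f) α
      ≥-direction = ~⋁-least λ { g (c , g≤f) → case-zero g c g≤f (EM {NonZero g}) }

    -- Φ is monotone, and reflects the order since Ψ ∘ Φ = id on regular open sets.
    Φ-order-iso : ∀ U V → IsRegularOpen U → IsRegularOpen V → (U ⊆ V ⇔ Φ U ≤ₚ Φ V)
    Φ-order-iso U V _ RV = mk⇔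
      (λ U⊆V α → Φ-least λ u uU → Φ-upper u (U⊆V u uU) α)
      (λ ΦU≤ΦV x ux → Equivalence.to (Ψ∘Φ≐id V RV (~⋁-thread _) x)
                        (≤ₚ-trans (Φ-upper x ux) ΦU≤ΦV))

proposition3p10 : ExcludedMiddle 0ℓ → (Λ : WellOrder) → (ℱ : CIS Λ) → IsoStatement ℱ
proposition3p10 EM Λ ℱ =
    (λ U _ → Φ-in-D U)
  , (λ f _ → Ψ-regular f)
  , Ψ∘Φ≐id
  , Φ∘Ψ≐id
  , Φ-order-iso
  where
  open IterationSystem ℱ
  open Classical EM
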